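{- For every $r\ge 3$, every edge-forcing set of the butterfly network $BF(r)$ has at least $2^r$ edges; that is, $\zeta_e(BF(r))\ge 2^r$.
   Context: The $r$-dimensional butterfly network $BF(r)$ has vertex set $\{[w;i] : w\in\{0,1\}^r,\ 0\le i\le r\}$ (vertex $[w;i]$ is at Level $i$), and $[w;i]$ is adjacent to $[w';j]$ iff $j=i+1$ and either $w=w'$ or $w$ and $w'$ differ precisely in the $j$-th bit. Forcing (closure) rule: for a graph $G=(V,E)$ and $T\subseteq V$, the closure $C_G(T)$ starts as $T$ and, as long as some vertex of $C_G(T)$ has exactly one neighbor not in $C_G(T)$, that neighbor is added. Edge-forcing set: a set $K$ of pairwise independent edges of $G$ such that, with $T$ the set of endpoints of edges of $K$, $C_G(T)=V$. $\zeta_e(G)$ denotes the minimum cardinality of an edge-forcing set of $G$. -}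

module Defs where

open import Data.Nat using (ℕ; suc)
open import Data.Fin using (Fin; toℕ)
open import Data.Bool using (Bool)
open import Data.Vec using (Vec; lookup)
open import Data.Product using (_×_; _,_; proj₁; proj₂; ∃-syntax)
open import Data.Sum using (_⊎_)
open import Data.List using (List)
open import Data.List.Membership.Propositional using (_∈_)
open import Relation.Nullary using (¬_)
open import Relation.Binary.PropositionalEquality using (_≡_; _≢_)

Vertex : ℕ → Set
Vertex r = Vec Bool r × Fin (suc r)

word : ∀ {r} → Vertex r → Vec Bool r
word = proj₁

level : ∀ {r} → Vertex r → Fin (suc r)
level = proj₂

-- w and w' differ precisely in the bit with (0-based) index k,
-- i.e. in the (k+1)-th bit with the paper's 1-based numbering.
DiffExactlyAt : ∀ {r} → Vec Bool r → Vec Bool r → Fin r → Set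
DiffExactlyAt w w' k =
  lookup w k ≢ lookup w' k × (∀ m → m ≢ k → lookup w m ≡ lookup w' m)

UpAdj : ∀ {r} → Vertex r → Vertex r → Set
UpAdj {r} (w , i) (w' , j) =
  toℕ j ≡ suc (toℕ i) ×
  (w ≡ w' ⊎ ∃[ k ] (suc (toℕ k) ≡ toℕ j × DiffExactlyAt w w' k))

Adj : ∀ {r} → Vertex r → Vertex r → Set
Adj u v = UpAdj u v ⊎ UpAdj v u

Endpoint : ∀ {r} → List (Vertex r × Vertex r) → Vertex r → Set
Endpoint K v = ∃[ e ] (e ∈ K × (v ≡ proj₁ e ⊎ v ≡ proj₂ e))

data Closure {r} (T : Vertex r → Set) : Vertex r → Set where
  base  : ∀ {v} → T v → Closure T v
  force : ∀ {u v} → Closure T u → Adj u v →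
          (∀ x → Adj u x → x ≢ v → Closure T x) → Closure T v

Independent : ∀ {r} → Vertex r × Vertex r → Vertex r × Vertex r → Set
Independent (a , b) (c , d) = a ≢ c × a ≢ d × b ≢ c × b ≢ d

-- In BF(r) the vertices [0c;0] and [1c;0] have the same neighbours, and so do [c0;r] and
-- [c1;r]. A vertex u can force one vertex of such a twin pair only once the other one, also a
-- neighbour of u, is in the closure; hence every one of these 2^r twin pairs contains an
-- endpoint of an edge of K. The twin pairs lie on levels 0 and r, so for r ≥ 2 no edge has
-- endpoints in two different twin pairs, and K has at least 2^r edges.
module Submission where

open import Defs
open import Data.Nat using (ℕ; zero; suc; s≤s; _≤_; _^_)
open import Data.Nat.Properties using (<-irrefl; 1+n≢n; suc-injective)
open import Data.Fin using (Fin; zero; suc; toℕ; fromℕ; finToFun; funToFin; combine; _≟_)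
open import Data.Fin.Properties using (toℕ-injective; toℕ<n; toℕ-fromℕ; funToFin-finToFin; injective⇒≤; 2↔Bool)
open import Data.Bool using (Bool; false; true; not)
open import Data.Bool.Properties using (not-¬; ¬-not)
open import Data.Vec using (Vec; []; _∷_; _∷ʳ_; lookup; tabulate; updateAt)
open import Data.Vec.Properties
  using (lookup∘updateAt; lookup∘updateAt′; lookup∘tabulate; tabulate∘lookup; tabulate-cong; ∷-injective; ∷ʳ-injective)
open import Data.Product using (_×_; _,_; proj₁; proj₂; ∃-syntax)
open import Data.Sum using (_⊎_; inj₁; inj₂; swap)
open import Data.List as List using (List; length)
open import Data.List.Membership.Propositional using (_∈_)
open import Data.List.Relation.Unary.All as All using (All)
open import Data.List.Relation.Unary.AllPairs using (AllPairs)
open import Data.List.Relation.Unary.Any using (index)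
open import Data.List.Relation.Unary.Any.Properties using (lookup-index)
open import Data.Empty using (⊥-elim)
open import Function using (_∘_; Injection)
open import Function.Properties.Inverse using (↔⇒↣)
open import Relation.Nullary using (¬_; yes; no)
open import Relation.Binary.PropositionalEquality
  using (_≡_; _≢_; _≗_; refl; sym; trans; cong; cong₂; subst; module ≡-Reasoning)

private
  variable
    n : ℕ

≗-lookup⇒≡ : {A : Set} {xs ys : Vec A n} → lookup xs ≗ lookup ys → xs ≡ ys
≗-lookup⇒≡ {xs = xs} {ys} eq =
  trans (sym (tabulate∘lookup xs)) (trans (tabulate-cong eq) (tabulate∘lookup ys))

flipAt : Fin n → Vec Bool n → Vec Bool n
flipAt k w = updateAt w k not

DiffExactlyAt-flipAt : (k : Fin n) (w : Vec Bool n) → DiffExactlyAt (flipAt k w) w k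
DiffExactlyAt-flipAt k w =
  (λ eq → not-¬ refl (trans (sym eq) (lookup∘updateAt k w))) ,
  (λ m m≢k → lookup∘updateAt′ m k m≢k w)

DiffExactlyAt-sym : ∀ {k} {w x : Vec Bool n} → DiffExactlyAt w x k → DiffExactlyAt x w k
DiffExactlyAt-sym (differ , agree) = differ ∘ sym , λ m m≢k → sym (agree m m≢k)

DiffExactlyAt⇒flipAt : ∀ {k} {w x : Vec Bool n} → DiffExactlyAt w x k → flipAt k w ≡ x
DiffExactlyAt⇒flipAt {k = k} {w} {x} (differ , agree) = ≗-lookup⇒≡ pointwise
  where
  pointwise : lookup (flipAt k w) ≗ lookup x
  pointwise m with m ≟ k
  ... | yes refl = trans (lookup∘updateAt k w) (sym (¬-not (differ ∘ sym)))
  ... | no m≢k   = trans (lookup∘updateAt′ m k m≢k w) (agree m m≢k)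

flipAt-last : (c : Vec Bool n) (b : Bool) → flipAt (fromℕ n) (c ∷ʳ b) ≡ c ∷ʳ not b
flipAt-last []      b = refl
flipAt-last (x ∷ c) b = cong (x ∷_) (flipAt-last c b)

level-determines-bit : ∀ {k k' : Fin n} {j : Fin (suc n)} →
  suc (toℕ k) ≡ toℕ j → suc (toℕ k') ≡ toℕ j → k' ≡ k
level-determines-bit k≈j k'≈j = toℕ-injective (suc-injective (trans k'≈j (sym k≈j)))

UpAdj-flipAtˡ : ∀ {k} {w x : Vec Bool n} {i j} → suc (toℕ k) ≡ toℕ j →
  UpAdj (w , i) (x , j) → UpAdj (flipAt k w , i) (x , j)
UpAdj-flipAtˡ {k = k} {w} k≈j (up , inj₁ refl) = up , inj₂ (k , k≈j , DiffExactlyAt-flipAt k w)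
UpAdj-flipAtˡ k≈j (up , inj₂ (k' , k'≈j , diff)) with level-determines-bit k≈j k'≈j
... | refl = up , inj₁ (DiffExactlyAt⇒flipAt diff)

UpAdj-flipAtʳ : ∀ {k} {w x : Vec Bool n} {i j} → suc (toℕ k) ≡ toℕ j →
  UpAdj (x , i) (w , j) → UpAdj (x , i) (flipAt k w , j)
UpAdj-flipAtʳ {k = k} {w} k≈j (up , inj₁ refl) =
  up , inj₂ (k , k≈j , DiffExactlyAt-sym {w = flipAt k w} {w} (DiffExactlyAt-flipAt k w))
UpAdj-flipAtʳ {w = w} {x} k≈j (up , inj₂ (k' , k'≈j , diff)) with level-determines-bit k≈j k'≈j
... | refl = up , inj₁ (sym (DiffExactlyAt⇒flipAt (DiffExactlyAt-sym {w = x} {w} diff)))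

bottom : Fin (suc (suc n))
bottom = zero

top : Fin (suc (suc n))
top {n} = fromℕ (suc n)

Adj-flipAt-bottom : ∀ {u} {w : Vec Bool (suc n)} → Adj u (w , bottom) → Adj u (flipAt zero w , bottom)
Adj-flipAt-bottom (inj₁ (() , _))
Adj-flipAt-bottom (inj₂ up@(1≈j , _)) = inj₂ (UpAdj-flipAtˡ (sym 1≈j) up)

no-level-above-top : (j : Fin (suc (suc n))) → toℕ j ≢ suc (toℕ (top {n}))
no-level-above-top {n} j j≈top+1 =
  <-irrefl (trans j≈top+1 (cong suc (toℕ-fromℕ (suc n)))) (toℕ<n j)

Adj-flipAt-top : ∀ {u} {w : Vec Bool (suc n)} → Adj u (w , top) → Adj u (flipAt (fromℕ n) w , top)
Adj-flipAt-top (inj₁ up) = inj₁ (UpAdj-flipAtʳ refl up)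
Adj-flipAt-top {u = _ , j} (inj₂ (j≈top+1 , _)) = ⊥-elim (no-level-above-top j j≈top+1)

TwinPair : ∀ {r} → (Bool → Vertex r) → Set
TwinPair p = ∀ b → p (not b) ≢ p b × (∀ {u} → Adj u (p b) → Adj u (p (not b)))

Closure-TwinPair : ∀ {r} {T : Vertex r → Set} {p : Bool → Vertex r} → TwinPair p →
  ∀ {b} → Closure T (p b) → ∃[ b' ] T (p b')
Closure-TwinPair twin     (base t)              = _ , t
Closure-TwinPair twin {b} (force _ u~pb closed) =
  Closure-TwinPair twin (closed _ (proj₂ (twin b) u~pb) (proj₁ (twin b)))

twinPair : Vec Bool (suc (suc n)) → Bool → Vertex (suc (suc n))
twinPair (false ∷ c) b = b ∷ c , bottom
twinPair (true  ∷ c) b = c ∷ʳ b , top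

twinPair-isTwinPair : (j : Vec Bool (suc (suc n))) → TwinPair (twinPair j)
twinPair-isTwinPair (false ∷ c) b =
  (λ eq → not-¬ refl (sym (proj₁ (∷-injective (cong proj₁ eq))))) ,
  Adj-flipAt-bottom
twinPair-isTwinPair (true ∷ c) b =
  (λ eq → not-¬ refl (sym (proj₂ (∷ʳ-injective c c (cong proj₁ eq))))) ,
  λ {u} → subst (λ w → Adj u (w , top)) (flipAt-last c b) ∘ Adj-flipAt-top

twinPair-injective : ∀ (j j' : Vec Bool (suc (suc n))) {b b'} → twinPair j b ≡ twinPair j' b' → j ≡ j'
twinPair-injective (false ∷ c) (false ∷ c') eq = cong (false ∷_) (proj₂ (∷-injective (cong proj₁ eq)))
twinPair-injective (true  ∷ c) (true  ∷ c') eq = cong (true ∷_) (proj₁ (∷ʳ-injective c c' (cong proj₁ eq)))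
twinPair-injective (false ∷ c) (true  ∷ c') ()
twinPair-injective (true  ∷ c) (false ∷ c') ()

twinPair-nonadjacent : ∀ (j j' : Vec Bool (suc (suc n))) {b b'} → ¬ UpAdj (twinPair j b) (twinPair j' b')
twinPair-nonadjacent (false ∷ c) (false ∷ c') (() , _)
twinPair-nonadjacent (false ∷ c) (true  ∷ c') (() , _)
twinPair-nonadjacent (true  ∷ c) (false ∷ c') (() , _)
twinPair-nonadjacent (true  ∷ c) (true  ∷ c') (top≈top+1 , _) = 1+n≢n (sym top≈top+1)

twinPair-separated : ∀ (j j' : Vec Bool (suc (suc n))) {b b'} →
  twinPair j b ≡ twinPair j' b' ⊎ Adj (twinPair j b) (twinPair j' b') → j ≡ j'
twinPair-separated j j' (inj₁ eq)        = twinPair-injective j j' eq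
twinPair-separated j j' (inj₂ (inj₁ up)) = ⊥-elim (twinPair-nonadjacent j j' up)
twinPair-separated j j' (inj₂ (inj₂ up)) = ⊥-elim (twinPair-nonadjacent j' j up)

funToFin-cong : ∀ {m} {f g : Fin n → Fin m} → f ≗ g → funToFin f ≡ funToFin g
funToFin-cong {n = zero}  f≗g = refl
funToFin-cong {n = suc n} f≗g = cong₂ combine (f≗g zero) (funToFin-cong (f≗g ∘ suc))

finToFun-injective : ∀ {m} {k l : Fin (m ^ n)} → finToFun {m} {n} k ≗ finToFun l → k ≡ l
finToFun-injective {n} {m} {k} {l} eq =
  trans (sym (funToFin-finToFin {n} {m} k)) (trans (funToFin-cong eq) (funToFin-finToFin {n} {m} l))

private
  module Fin2↣Bool = Injection (↔⇒↣ 2↔Bool)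

bits : Fin (2 ^ n) → Vec Bool n
bits {n} k = tabulate (Fin2↣Bool.to ∘ finToFun {2} {n} k)

bits-injective : ∀ {k l : Fin (2 ^ n)} → bits k ≡ bits l → k ≡ l
bits-injective {n} {k} {l} eq = finToFun-injective λ i → Fin2↣Bool.injective (begin
  Fin2↣Bool.to (finToFun k i)       ≡⟨ lookup∘tabulate (Fin2↣Bool.to ∘ finToFun {2} {n} k) i ⟨
  lookup (bits k) i                 ≡⟨ cong (λ w → lookup w i) eq ⟩
  lookup (bits l) i                 ≡⟨ lookup∘tabulate (Fin2↣Bool.to ∘ finToFun {2} {n} l) i ⟩
  Fin2↣Bool.to (finToFun l i)       ∎)
  where open ≡-Reasoning

≤length-by-witnesses : {A : Set} {xs : List A} (P : Fin n → A → Set) →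
  (∀ i → ∃[ x ] (x ∈ xs × P i x)) →
  (∀ {i j x} → x ∈ xs → P i x → P j x → i ≡ j) → n ≤ length xs
≤length-by-witnesses {xs = xs} P witness unique = injective⇒≤ position-injective
  where
  member : ∀ i → proj₁ (witness i) ∈ xs
  member i = proj₁ (proj₂ (witness i))

  position : Fin _ → Fin (length xs)
  position i = index (member i)

  position-injective : ∀ {i j} → position i ≡ position j → i ≡ j
  position-injective {i} {j} eq =
    unique (member i) (proj₂ (proj₂ (witness i)))
      (subst (P j) (sym same-witness) (proj₂ (proj₂ (witness j))))
    where
    same-witness : proj₁ (witness i) ≡ proj₁ (witness j)
    same-witness =
      trans (lookup-index (member i)) (trans (cong (List.lookup xs) eq) (sym (lookup-index (member j))))

endpoints-equal-or-adjacent : ∀ {r} {x y t t' : Vertex r} → Adj x y →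
  (t ≡ x ⊎ t ≡ y) → (t' ≡ x ⊎ t' ≡ y) → t ≡ t' ⊎ Adj t t'
endpoints-equal-or-adjacent x~y (inj₁ refl) (inj₁ refl) = inj₁ refl
endpoints-equal-or-adjacent x~y (inj₁ refl) (inj₂ refl) = inj₂ x~y
endpoints-equal-or-adjacent x~y (inj₂ refl) (inj₁ refl) = inj₂ (swap x~y)
endpoints-equal-or-adjacent x~y (inj₂ refl) (inj₂ refl) = inj₁ refl

lemma4p2 : (r : ℕ) → 3 ≤ r → (K : List (Vertex r × Vertex r)) →
    All (λ e → Adj (proj₁ e) (proj₂ e)) K → AllPairs Independent K →
    (∀ v → Closure (Endpoint K) v) → 2 ^ r ≤ length K
lemma4p2 zero          ()
lemma4p2 (suc zero)    (s≤s ())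
lemma4p2 (suc (suc n)) _ K adjacent _ closed = ≤length-by-witnesses MeetsTwinPair meets separated
  where
  MeetsTwinPair : Fin (2 ^ suc (suc n)) → Vertex (suc (suc n)) × Vertex (suc (suc n)) → Set
  MeetsTwinPair k e = ∃[ b ] (twinPair (bits k) b ≡ proj₁ e ⊎ twinPair (bits k) b ≡ proj₂ e)

  meets : ∀ k → ∃[ e ] (e ∈ K × MeetsTwinPair k e)
  meets k with Closure-TwinPair (twinPair-isTwinPair (bits k)) (closed (twinPair (bits k) false))
  ... | b , e , e∈K , incident = e , e∈K , b , incident

  separated : ∀ {k l e} → e ∈ K → MeetsTwinPair k e → MeetsTwinPair l e → k ≡ l
  separated {k} {l} e∈K (_ , incident) (_ , incident') =
    bits-injective (twinPair-separated (bits k) (bits l)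
      (endpoints-equal-or-adjacent (All.lookup adjacent e∈K) incident incident'))
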